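{- Let $m\le n$ be positive integers and $k\in[n]$. Then $$|Sh_m(k-1,n-k)|=\begin{cases}\binom{m-1}{n-k}(n-m+1)\,k^{m-n+k-2}(n-k+1)^{n-k-1}&\text{if }k>n-m+1,\\ m^{m-2}&\text{if }k=n-m+1,\\ 0&\text{if }k<n-m+1.\end{cases}$$
   Context: $[n]=\{1,\dots,n\}$. For integers $0\le r\le s$, $\mathrm{PF}_{r,s}$ is the set of sequences $(c_1,\dots,c_r)\in[s]^r$ whose nondecreasing rearrangement $c'_1\le\dots\le c'_r$ satisfies $c'_i\le s-r+i$ for all $i$; $\mathrm{PF}_{0,s}$ contains only the empty sequence, and $\mathrm{PF}_{r,s}=\emptyset$ if $r<0$ or $r>s$. $Sh_m(k-1,n-k)$ is the set of all sequences of length $m-1$ that are shuffles (interleavings preserving the internal order of each word) of some word $\gamma\in\mathrm{PF}_{m-n+k-1,k-1}$ and the word $(b_1+k,\dots,b_{n-k}+k)$ for some $(b_1,\dots,b_{n-k})\in\mathrm{PF}_{n-k,n-k}$. -}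

module Defs where

open import Data.Nat using (ℕ; suc; _+_; _*_; _∸_; _^_; _≤_)
open import Data.Nat.Combinatorics using (_C_)
open import Data.Fin using (Fin; toℕ)
open import Data.List using (List; length; lookup; map)
open import Data.List.Relation.Unary.All using (All)
open import Data.List.Relation.Unary.Linked using (Linked)
open import Data.List.Relation.Unary.Unique.Propositional using (Unique)
open import Data.List.Relation.Binary.Permutation.Propositional using (_↭_)
open import Data.List.Relation.Ternary.Interleaving.Propositional using (Interleaving)
open import Data.List.Membership.Propositional using (_∈_)
open import Data.Product using (Σ; _×_; ∃)
open import Relation.Binary.PropositionalEquality using (_≡_)

-- c ∈ PF_{r,s} with r = length c:
-- entries in [s], and the nondecreasing rearrangement c' satisfies
-- c'_i ≤ s - r + i (1-indexed), written without truncated subtraction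
-- as c'_i + r ≤ s + i.
IsPF : ℕ → List ℕ → Set
IsPF s c =
  All (λ x → 1 ≤ x × x ≤ s) c ×
  Σ (List ℕ) λ c' → (c' ↭ c) × Linked _≤_ c' ×
    ((i : Fin (length c')) → lookup c' i + length c ≤ s + suc (toℕ i))

-- The length condition |γ| = m-n+k-1 is stated as |γ| + (n-k) + 1 = m
-- (so that PF_{r,s} = ∅ for r < 0 is respected).
IsSh : ℕ → ℕ → ℕ → List ℕ → Set
IsSh m n k w =
  Σ (List ℕ) λ γ → Σ (List ℕ) λ b →
    IsPF (k ∸ 1) γ × length γ + (n ∸ k) + 1 ≡ m ×
    IsPF (n ∸ k) b × length b ≡ n ∸ k ×
    Interleaving γ (map (_+ k) b) w

HasSize : (List ℕ → Set) → ℕ → Set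
HasSize P N =
  Σ (List (List ℕ)) λ xs → Unique xs ×
    ((w : List ℕ) → (w ∈ xs → P w) × (P w → w ∈ xs)) × length xs ≡ N

shCount : ℕ → ℕ → ℕ → ℕ
shCount m n k =
  ((m ∸ 1) C (n ∸ k)) * (n ∸ m + 1) * k ^ (m + k ∸ (n + 2)) * (n ∸ k + 1) ^ (n ∸ k ∸ 1)

-- A shuffle in Sh_m(k-1, n-k) interleaves γ ∈ PF_{r,k-1}, r = m-n+k-1, whose entries are at most
-- k-1, with a word whose entries all exceed k; filtering by the threshold k-1 recovers both words,
-- so |Sh| = |PF_{r,k-1}| · |PF_{t,t}| · C(r+t, t) with t = n-k, and the set is empty when r < 0.
-- The count |PF_{r,s}| = (s+1-r)(s+1)^(r-1) comes from sorting PF_{r,s+1} by the number of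
-- entries equal to 1: deleting them and lowering the remaining entries by one gives a member of
-- PF_{r-j,s}, whence |PF_{r,s+1}| = Σ_b C(r,b) |PF_{b,s}|, an Abel-type identity that follows from
-- the binomial theorem and its derivative.
module Submission where

open import Defs

open import Algebra.Properties.CommutativeSemigroup as CSemigroup using ()
open import Data.Empty using (⊥-elim)
open import Data.Fin using (Fin; zero; suc; toℕ)
open import Data.List using (List; []; _∷_; _++_; map; length; lookup; replicate; filter; concatMap; applyUpTo; upTo)
open import Data.List.Properties
  using (∷-injectiveˡ; ∷-injectiveʳ; length-++; length-map; length-replicate; length-filter; map-∘; map-id; map-injective;
         filter-accept; filter-reject; filter-all)
open import Data.List.Membership.Propositional using (_∈_; find; lose)
open import Data.List.Membership.Propositional.Properties
  using (∈-++⁺ˡ; ∈-++⁺ʳ; ∈-++⁻; ∈-map⁺; ∈-map⁻; ∈-concatMap⁺; ∈-concatMap⁻; ∈-upTo⁺; ∈-upTo⁻)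
open import Data.List.Relation.Binary.Disjoint.Propositional using (Disjoint)
open import Data.List.Relation.Binary.Permutation.Propositional using (_↭_; ↭-sym)
open import Data.List.Relation.Binary.Permutation.Propositional.Properties as ↭
  using (All-resp-↭; ↭-length; ↭-empty-inv; filter-↭)
import Data.List.Relation.Binary.Pointwise as Pointwise
open import Data.List.Relation.Unary.All as All using (All; []; _∷_)
open import Data.List.Relation.Unary.All.Properties using (all-filter)
open import Data.List.Relation.Unary.AllPairs using ([]; _∷_)
open import Data.List.Relation.Unary.Any using (here; there)
open import Data.List.Relation.Unary.Linked as Linked using (Linked)
open import Data.List.Relation.Unary.Linked.Properties as Linkedₚ using (Linked⇒All)
open import Data.List.Relation.Unary.Unique.Propositional using (Unique)
import Data.List.Relation.Unary.Unique.Propositional.Properties as Uniqueₚ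
open import Data.List.Relation.Ternary.Interleaving using ([]; left; right)
open import Data.List.Relation.Ternary.Interleaving.Properties using (interleave-length)
open import Data.List.Relation.Ternary.Interleaving.Propositional using (Interleaving; consˡ; consʳ)
open import Data.Nat
open import Data.Nat.Combinatorics using (_C_; nCn≡1; k>n⇒nCk≡0; nCk+nC[k+1]≡[n+1]C[k+1])
open import Data.Nat.Properties
open import Data.Nat.Tactic.RingSolver using (solve-∀)
open import Data.List.Sort ≤-decTotalOrder using (sort; sort-↭; sort-↗)
open import Data.Product using (Σ; ∃; _×_; _,_; proj₁; proj₂)
open import Data.Sum using (inj₁; inj₂)
open import Data.Unit using (⊤; tt)
open import Function using (_∘_; id)
open import Function.Bundles using (_⇔_; mk⇔; Equivalence)
open import Level using (0ℓ)
open import Relation.Nullary using (¬_; yes; no)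
open import Relation.Unary using (Pred; Decidable; ∁)
open import Relation.Unary.Properties using (∁?)
open import Relation.Binary.PropositionalEquality
open ≡-Reasoning

open Equivalence using (to; from)
open CSemigroup +-commutativeSemigroup using () renaming (interchange to +-interchange)
open CSemigroup *-commutativeSemigroup using () renaming (x∙yz≈y∙xz to *-left-comm)

-- Binomial sums

∑≤ : ℕ → (ℕ → ℕ) → ℕ
∑≤ zero    g = g 0
∑≤ (suc r) g = g 0 + ∑≤ r (g ∘ suc)

∑≤-cong : ∀ r {f g} → (∀ {b} → b ≤ r → f b ≡ g b) → ∑≤ r f ≡ ∑≤ r g
∑≤-cong zero    f≗g = f≗g z≤n
∑≤-cong (suc r) f≗g = cong₂ _+_ (f≗g z≤n) (∑≤-cong r (f≗g ∘ s≤s))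

∑≤-distrib-+ : ∀ r f g → ∑≤ r (λ b → f b + g b) ≡ ∑≤ r f + ∑≤ r g
∑≤-distrib-+ zero    f g = refl
∑≤-distrib-+ (suc r) f g =
  trans (cong (f 0 + g 0 +_) (∑≤-distrib-+ r (f ∘ suc) (g ∘ suc))) (+-interchange (f 0) (g 0) _ _)

*-distribˡ-∑≤ : ∀ r y f → y * ∑≤ r f ≡ ∑≤ r (λ b → y * f b)
*-distribˡ-∑≤ zero    y f = refl
*-distribˡ-∑≤ (suc r) y f =
  trans (*-distribˡ-+ y (f 0) _) (cong (y * f 0 +_) (*-distribˡ-∑≤ r y (f ∘ suc)))

∑≤-last : ∀ r g → ∑≤ (suc r) g ≡ ∑≤ r g + g (suc r)
∑≤-last zero    g = refl
∑≤-last (suc r) g = trans (cong (g 0 +_) (∑≤-last r (g ∘ suc))) (sym (+-assoc (g 0) _ _))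

∑≤-pascal : ∀ r (h : ℕ → ℕ) → ∑≤ (suc r) (λ b → (suc r C b) * h b) ≡
            ∑≤ r (λ b → (r C b) * h b) + ∑≤ r (λ b → (r C b) * h (suc b))
∑≤-pascal r h = begin
  h 0 + 0 + ∑≤ r (λ b → (suc r C suc b) * h (suc b))
    ≡⟨ cong (h 0 + 0 +_) (trans (∑≤-cong r λ {b} _ → pascal b) (∑≤-distrib-+ r _ _)) ⟩
  h 0 + 0 + (∑≤ r (λ b → (r C suc b) * h (suc b)) + ∑≤ r (λ b → (r C b) * h (suc b)))
    ≡⟨ sym (+-assoc (h 0 + 0) _ _) ⟩
  ∑≤ (suc r) (λ b → (r C b) * h b) + ∑≤ r (λ b → (r C b) * h (suc b))
    ≡⟨ cong (_+ ∑≤ r (λ b → (r C b) * h (suc b))) drop-last ⟩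
  ∑≤ r (λ b → (r C b) * h b) + ∑≤ r (λ b → (r C b) * h (suc b)) ∎
  where
  pascal : ∀ b → (suc r C suc b) * h (suc b) ≡ (r C suc b) * h (suc b) + (r C b) * h (suc b)
  pascal b = trans (cong (_* h (suc b)) (trans (sym (nCk+nC[k+1]≡[n+1]C[k+1] r b)) (+-comm (r C b) _)))
                   (*-distribʳ-+ (h (suc b)) (r C suc b) (r C b))
  drop-last : ∑≤ (suc r) (λ b → (r C b) * h b) ≡ ∑≤ r (λ b → (r C b) * h b)
  drop-last = begin
    ∑≤ (suc r) (λ b → (r C b) * h b)               ≡⟨ ∑≤-last r _ ⟩
    ∑≤ r (λ b → (r C b) * h b) + (r C suc r) * h (suc r)
      ≡⟨ cong (λ c → ∑≤ r (λ b → (r C b) * h b) + c * h (suc r)) (k>n⇒nCk≡0 (n<1+n r)) ⟩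
    ∑≤ r (λ b → (r C b) * h b) + 0                  ≡⟨ +-identityʳ _ ⟩
    ∑≤ r (λ b → (r C b) * h b)                      ∎

binomial-theorem : ∀ r y → ∑≤ r (λ b → (r C b) * y ^ b) ≡ suc y ^ r
binomial-theorem zero    y = refl
binomial-theorem (suc r) y = begin
  ∑≤ (suc r) (λ b → (suc r C b) * y ^ b)                  ≡⟨ ∑≤-pascal r (y ^_) ⟩
  ∑≤ r (λ b → (r C b) * y ^ b) + ∑≤ r (λ b → (r C b) * (y * y ^ b))
    ≡⟨ cong (∑≤ r (λ b → (r C b) * y ^ b) +_)
         (trans (∑≤-cong r λ {b} _ → *-left-comm (r C b) y (y ^ b)) (sym (*-distribˡ-∑≤ r y _))) ⟩
  ∑≤ r (λ b → (r C b) * y ^ b) + y * ∑≤ r (λ b → (r C b) * y ^ b)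
    ≡⟨ cong (λ z → z + y * z) (binomial-theorem r y) ⟩
  suc y ^ r + y * suc y ^ r                             ∎

derivPow : ℕ → ℕ → ℕ
derivPow zero    y = 0
derivPow (suc b) y = suc b * y ^ b

*-derivPow : ∀ b y → y * derivPow b y ≡ b * y ^ b
*-derivPow zero    y = *-zeroʳ y
*-derivPow (suc b) y = *-left-comm y (suc b) (y ^ b)

derivPow-suc : ∀ b y → derivPow (suc b) y ≡ y ^ b + y * derivPow b y
derivPow-suc b y = cong (y ^ b +_) (sym (*-derivPow b y))

binomial-theorem-derivative : ∀ r y → ∑≤ r (λ b → (r C b) * derivPow b y) ≡ derivPow r (suc y)
binomial-theorem-derivative zero    y = refl
binomial-theorem-derivative (suc r) y = begin
  ∑≤ (suc r) (λ b → (suc r C b) * derivPow b y)            ≡⟨ ∑≤-pascal r (λ b → derivPow b y) ⟩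
  D + ∑≤ r (λ b → (r C b) * derivPow (suc b) y)
    ≡⟨ cong (D +_) (trans (∑≤-cong r λ {b} _ → expand b) (∑≤-distrib-+ r _ _)) ⟩
  D + (∑≤ r (λ b → (r C b) * y ^ b) + ∑≤ r (λ b → y * ((r C b) * derivPow b y)))
    ≡⟨ cong (λ z → D + (∑≤ r (λ b → (r C b) * y ^ b) + z)) (sym (*-distribˡ-∑≤ r y _)) ⟩
  D + (∑≤ r (λ b → (r C b) * y ^ b) + y * D)
    ≡⟨ cong₂ (λ d p → d + (p + y * d)) (binomial-theorem-derivative r y) (binomial-theorem r y) ⟩
  derivPow r (suc y) + (suc y ^ r + y * derivPow r (suc y))
    ≡⟨ solve-∀′ (derivPow r (suc y)) (suc y ^ r) y ⟩
  suc y ^ r + suc y * derivPow r (suc y)                 ≡⟨ cong (suc y ^ r +_) (*-derivPow r (suc y)) ⟩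
  suc y ^ r + r * suc y ^ r                              ∎
  where
  D : ℕ
  D = ∑≤ r (λ b → (r C b) * derivPow b y)
  expand : ∀ b → (r C b) * derivPow (suc b) y ≡ (r C b) * y ^ b + y * ((r C b) * derivPow b y)
  expand b = trans (cong ((r C b) *_) (derivPow-suc b y))
                   (trans (*-distribˡ-+ (r C b) _ _) (cong ((r C b) * y ^ b +_) (*-left-comm (r C b) y _)))
  solve-∀′ : ∀ d p y → d + (p + y * d) ≡ p + suc y * d
  solve-∀′ = solve-∀

pfCount : ℕ → ℕ → ℕ
pfCount zero    s = 1
pfCount (suc b) s = (s ∸ b) * suc s ^ b

pfCount+derivPow : ∀ b s → b ≤ suc s → pfCount b s + derivPow b (suc s) ≡ suc s ^ b
pfCount+derivPow zero    s _         = refl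
pfCount+derivPow (suc b) s (s≤s b≤s) = begin
  (s ∸ b) * suc s ^ b + suc b * suc s ^ b ≡⟨ *-distribʳ-+ (suc s ^ b) (s ∸ b) (suc b) ⟨
  (s ∸ b + suc b) * suc s ^ b
    ≡⟨ cong (_* suc s ^ b) (trans (+-suc (s ∸ b) b) (cong suc (m∸n+n≡m b≤s))) ⟩
  suc s * suc s ^ b                       ∎

-- Since pfCount b s = (s + 1) ^ b - derivPow b (s + 1), this is the binomial theorem
-- at y = s + 1 minus its derivative.
∑≤-pfCount : ∀ r s → r ≤ suc s → ∑≤ r (λ b → (r C b) * pfCount b s) ≡ pfCount r (suc s)
∑≤-pfCount r s r≤1+s = +-cancelʳ-≡ _ _ _ (begin
  ∑≤ r (λ b → (r C b) * pfCount b s) + derivPow r (suc (suc s))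
    ≡⟨ cong (∑≤ r (λ b → (r C b) * pfCount b s) +_) (binomial-theorem-derivative r (suc s)) ⟨
  ∑≤ r (λ b → (r C b) * pfCount b s) + ∑≤ r (λ b → (r C b) * derivPow b (suc s))
    ≡⟨ ∑≤-distrib-+ r _ _ ⟨
  ∑≤ r (λ b → (r C b) * pfCount b s + (r C b) * derivPow b (suc s))
    ≡⟨ ∑≤-cong r (λ {b} b≤r → trans (sym (*-distribˡ-+ (r C b) _ _))
                                    (cong ((r C b) *_) (pfCount+derivPow b s (≤-trans b≤r r≤1+s)))) ⟩
  ∑≤ r (λ b → (r C b) * suc s ^ b)                 ≡⟨ binomial-theorem r (suc s) ⟩
  suc (suc s) ^ r                                 ≡⟨ pfCount+derivPow r (suc s) (m≤n⇒m≤1+n r≤1+s) ⟨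
  pfCount r (suc s) + derivPow r (suc (suc s))     ∎)

pfCount-diagonal : ∀ t → pfCount t t ≡ (t + 1) ^ (t ∸ 1)
pfCount-diagonal zero    = refl
pfCount-diagonal (suc t) = begin
  (suc t ∸ t) * suc (suc t) ^ t ≡⟨ cong (_* suc (suc t) ^ t) (m+n∸n≡m 1 t) ⟩
  1 * suc (suc t) ^ t           ≡⟨ *-identityˡ _ ⟩
  suc (suc t) ^ t               ≡⟨ cong (_^ t) (+-comm 1 (suc t)) ⟩
  (suc t + 1) ^ t               ∎

-- Enumerations and shuffles

module _ {A B : Set} (f : A → List B) where

  Unique-concatMap⁺ : ∀ {xs} → Unique xs → (∀ {x} → x ∈ xs → Unique (f x)) →
    (∀ {x y w} → x ∈ xs → y ∈ xs → w ∈ f x → w ∈ f y → x ≡ y) → Unique (concatMap f xs)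
  Unique-concatMap⁺ {[]}     _          _       _   = []
  Unique-concatMap⁺ {x ∷ xs} (x∉xs ∷ u) uniqueF inj =
    Uniqueₚ.++⁺ (uniqueF (here refl))
               (Unique-concatMap⁺ u (uniqueF ∘ there) λ x∈ y∈ → inj (there x∈) (there y∈))
               disjoint
    where
    disjoint : Disjoint (f x) (concatMap f xs)
    disjoint (w∈fx , w∈rest) with y , y∈xs , w∈fy ← find (∈-concatMap⁻ f w∈rest) =
      All.lookup x∉xs y∈xs (inj (here refl) (there y∈xs) w∈fx w∈fy)

  length-concatMap-const : ∀ {xs c} → (∀ {x} → x ∈ xs → length (f x) ≡ c) →
                           length (concatMap f xs) ≡ length xs * c
  length-concatMap-const {[]}     _ = refl
  length-concatMap-const {x ∷ xs} lengthF =
    trans (length-++ (f x)) (cong₂ _+_ (lengthF (here refl)) (length-concatMap-const (lengthF ∘ there)))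

  length-concatMap-applyUpTo : ∀ r (h : ℕ → A) →
    length (concatMap f (applyUpTo h (suc r))) ≡ ∑≤ r (length ∘ f ∘ h)
  length-concatMap-applyUpTo zero    h = trans (length-++ (f (h 0))) (+-identityʳ _)
  length-concatMap-applyUpTo (suc r) h =
    trans (length-++ (f (h 0))) (cong (length (f (h 0)) +_) (length-concatMap-applyUpTo r (h ∘ suc)))

module _ {A : Set} where

  shuffles : List A → List A → List (List A)
  shuffles []       ys       = ys ∷ []
  shuffles (x ∷ xs) []       = (x ∷ xs) ∷ []
  shuffles (x ∷ xs) (y ∷ ys) = map (x ∷_) (shuffles xs (y ∷ ys)) ++ map (y ∷_) (shuffles (x ∷ xs) ys)

  ∈-shuffles⁻ : ∀ xs ys {w} → w ∈ shuffles xs ys → Interleaving xs ys w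
  ∈-shuffles⁻ []       ys       (here refl) = right (Pointwise.refl refl)
  ∈-shuffles⁻ (x ∷ xs) []       (here refl) = left (Pointwise.refl refl)
  ∈-shuffles⁻ (x ∷ xs) (y ∷ ys) w∈ with ∈-++⁻ (map (x ∷_) (shuffles xs (y ∷ ys))) w∈
  ... | inj₁ w∈ˡ with v , v∈ , refl ← ∈-map⁻ (x ∷_) w∈ˡ = consˡ (∈-shuffles⁻ xs (y ∷ ys) v∈)
  ... | inj₂ w∈ʳ with v , v∈ , refl ← ∈-map⁻ (y ∷_) w∈ʳ = consʳ (∈-shuffles⁻ (x ∷ xs) ys v∈)

  ∈-shuffles⁺ : ∀ {xs ys w} → Interleaving xs ys w → w ∈ shuffles xs ys
  ∈-shuffles⁺ [] = here refl
  ∈-shuffles⁺ {[]} (consʳ p) with here refl ← ∈-shuffles⁺ p = here refl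
  ∈-shuffles⁺ {_ ∷ []} {[]} (consˡ []) = here refl
  ∈-shuffles⁺ {_ ∷ _ ∷ _} {[]} (consˡ p) with here refl ← ∈-shuffles⁺ p = here refl
  ∈-shuffles⁺ {x ∷ xs} {_ ∷ _} (consˡ p) = ∈-++⁺ˡ (∈-map⁺ (x ∷_) (∈-shuffles⁺ p))
  ∈-shuffles⁺ {x ∷ xs} {y ∷ _} (consʳ p) =
    ∈-++⁺ʳ (map (x ∷_) (shuffles xs _)) (∈-map⁺ (y ∷_) (∈-shuffles⁺ p))

  length-shuffles : ∀ xs ys → length (shuffles xs ys) ≡ (length xs + length ys) C length ys
  length-shuffles []       ys       = sym (nCn≡1 (length ys))
  length-shuffles (x ∷ xs) []       = refl
  length-shuffles (x ∷ xs) (y ∷ ys) = begin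
    length (map (x ∷_) (shuffles xs (y ∷ ys)) ++ map (y ∷_) (shuffles (x ∷ xs) ys))
      ≡⟨ length-++ (map (x ∷_) (shuffles xs (y ∷ ys))) ⟩
    length (map (x ∷_) (shuffles xs (y ∷ ys))) + length (map (y ∷_) (shuffles (x ∷ xs) ys))
      ≡⟨ cong₂ _+_ (length-map (x ∷_) (shuffles xs (y ∷ ys))) (length-map (y ∷_) (shuffles (x ∷ xs) ys)) ⟩
    length (shuffles xs (y ∷ ys)) + length (shuffles (x ∷ xs) ys)
      ≡⟨ cong₂ _+_ (length-shuffles xs (y ∷ ys)) (length-shuffles (x ∷ xs) ys) ⟩
    (a + suc b) C suc b + (suc a + b) C b
      ≡⟨ cong (λ n → n C suc b + (suc a + b) C b) (+-suc a b) ⟩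
    (suc a + b) C suc b + (suc a + b) C b
      ≡⟨ +-comm ((suc a + b) C suc b) _ ⟩
    (suc a + b) C b + (suc a + b) C suc b
      ≡⟨ nCk+nC[k+1]≡[n+1]C[k+1] (suc a + b) b ⟩
    suc (suc a + b) C suc b
      ≡⟨ cong (_C suc b) (+-suc (suc a) b) ⟨
    (suc a + suc b) C suc b ∎
    where
    a b : ℕ
    a = length xs
    b = length ys

  Unique-shuffles : ∀ {xs ys} → Disjoint xs ys → Unique (shuffles xs ys)
  Unique-shuffles {[]}     {ys}     _        = [] ∷ []
  Unique-shuffles {x ∷ xs} {[]}     _        = [] ∷ []
  Unique-shuffles {x ∷ xs} {y ∷ ys} disjoint =
    Uniqueₚ.++⁺ (Uniqueₚ.map⁺ ∷-injectiveʳ (Unique-shuffles λ (v∈xs , v∈ys) → disjoint (there v∈xs , v∈ys)))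
               (Uniqueₚ.map⁺ ∷-injectiveʳ (Unique-shuffles λ (v∈xs , v∈ys) → disjoint (v∈xs , there v∈ys)))
               heads-differ
    where
    heads-differ : Disjoint (map (x ∷_) (shuffles xs (y ∷ ys))) (map (y ∷_) (shuffles (x ∷ xs) ys))
    heads-differ (p , q) with _ , _ , refl ← ∈-map⁻ (x ∷_) p | _ , _ , x∷≡y∷ ← ∈-map⁻ (y ∷_) q =
      disjoint (here refl , here (∷-injectiveˡ x∷≡y∷))

module _ {A : Set} {P : Pred A 0ℓ} where

  All-interleaving⁺ : ∀ {xs ys w} → All P xs → All P ys → Interleaving xs ys w → All P w
  All-interleaving⁺ _          _          []        = []
  All-interleaving⁺ (px ∷ pxs) pys        (consˡ i) = px ∷ All-interleaving⁺ pxs pys i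
  All-interleaving⁺ pxs        (py ∷ pys) (consʳ i) = py ∷ All-interleaving⁺ pxs pys i

  All-interleaving⁻ : ∀ {xs ys w} → All P w → Interleaving xs ys w → All P xs × All P ys
  All-interleaving⁻ _          []        = [] , []
  All-interleaving⁻ (pw ∷ pws) (consˡ i) = let pxs , pys = All-interleaving⁻ pws i in pw ∷ pxs , pys
  All-interleaving⁻ (pw ∷ pws) (consʳ i) = let pxs , pys = All-interleaving⁻ pws i in pxs , pw ∷ pys

  module _ (P? : Decidable P) where

    interleaving-filter : ∀ w → Interleaving (filter P? w) (filter (∁? P?) w) w
    interleaving-filter []      = []
    interleaving-filter (x ∷ w) with P? x
    ... | yes _ = consˡ (interleaving-filter w)
    ... | no  _ = consʳ (interleaving-filter w)

    interleaving⇒filter : ∀ {xs ys w} → All P xs → All (∁ P) ys → Interleaving xs ys w →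
                          filter P? w ≡ xs × filter (∁? P?) w ≡ ys
    interleaving⇒filter _ _ [] = refl , refl
    interleaving⇒filter {w = x ∷ w} (px ∷ pxs) pys (consˡ i)
      rewrite filter-accept P? {xs = w} px | filter-reject (∁? P?) {xs = w} (λ ¬px → ¬px px) =
      let eqˡ , eqʳ = interleaving⇒filter pxs pys i in cong (x ∷_) eqˡ , eqʳ
    interleaving⇒filter {w = y ∷ w} pxs (¬py ∷ pys) (consʳ i)
      rewrite filter-reject P? {xs = w} ¬py | filter-accept (∁? P?) {xs = w} ¬py =
      let eqˡ , eqʳ = interleaving⇒filter pxs pys i in eqˡ , cong (y ∷_) eqʳ

Disjoint-All-∁ : ∀ {A : Set} {P : Pred A 0ℓ} {xs ys} → All P xs → All (∁ P) ys → Disjoint xs ys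
Disjoint-All-∁ pxs ¬pys (v∈xs , v∈ys) = All.lookup ¬pys v∈ys (All.lookup pxs v∈xs)

-- Parking functions

InRange : ℕ → ℕ → Set
InRange s x = 1 ≤ x × x ≤ s

lower : List ℕ → List ℕ
lower w = map pred (filter (∁? (_≤? 1)) w)

-- A sequence lies in PF_{r,s+1} iff its entries lie in [s+1], r ≤ s+1, and lowering it gives
-- a sequence in PF_{r-j,s}, j being its number of 1s.
IsPFʳ : ℕ → List ℕ → Set
IsPFʳ zero    w = w ≡ []
IsPFʳ (suc s) w = All (InRange (suc s)) w × length w ≤ suc s × IsPFʳ s (lower w)

IsPFʳ⇒InRange : ∀ s {w} → IsPFʳ s w → All (InRange s) w
IsPFʳ⇒InRange zero    refl          = []
IsPFʳ⇒InRange (suc s) (inRange , _) = inRange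

IsPFʳ⇒length≤ : ∀ s {w} → IsPFʳ s w → length w ≤ s
IsPFʳ⇒length≤ zero    refl             = z≤n
IsPFʳ⇒length≤ (suc s) (_ , length≤ , _) = length≤

withOnes : ℕ → List ℕ → List (List ℕ)
withOnes j d = shuffles (replicate j 1) (map suc d)

All-≤1-replicate : ∀ j → All (_≤ 1) (replicate j 1)
All-≤1-replicate zero    = []
All-≤1-replicate (suc j) = ≤-refl ∷ All-≤1-replicate j

All-≰1-map-suc : ∀ {d} → All (1 ≤_) d → All (∁ (_≤ 1)) (map suc d)
All-≰1-map-suc []           = []
All-≰1-map-suc (1≤x ∷ 1≤xs) = <⇒≱ (s≤s 1≤x) ∷ All-≰1-map-suc 1≤xs

interleaving⇒lower : ∀ {j d w} → All (1 ≤_) d → Interleaving (replicate j 1) (map suc d) w → lower w ≡ d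
interleaving⇒lower {j} {d} {w} 1≤d i = begin
  map pred (filter (∁? (_≤? 1)) w)
    ≡⟨ cong (map pred) (proj₂ (interleaving⇒filter (_≤? 1) (All-≤1-replicate j) (All-≰1-map-suc 1≤d) i)) ⟩
  map pred (map suc d)             ≡⟨ map-∘ d ⟨
  map (pred ∘ suc) d               ≡⟨ map-id d ⟩
  d                                ∎

replicate-1 : ∀ {o} → All (_≤ 1) o → All (1 ≤_) o → o ≡ replicate (length o) 1
replicate-1 []             []         = refl
replicate-1 (x≤1 ∷ xs≤1) (1≤x ∷ 1≤xs) = cong₂ _∷_ (≤-antisym x≤1 1≤x) (replicate-1 xs≤1 1≤xs)

map-suc-pred : ∀ {h} → All (1 ≤_) h → map suc (map pred h) ≡ h
map-suc-pred []                   = refl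
map-suc-pred {suc x ∷ _} (_ ∷ 1≤h) = cong (suc x ∷_) (map-suc-pred 1≤h)

interleaving-lower : ∀ {w} → All (1 ≤_) w →
  Interleaving (replicate (length w ∸ length (lower w)) 1) (map suc (lower w)) w
interleaving-lower {w} 1≤w = subst₂ (λ o h → Interleaving o h w) ones≡ highs≡ i
  where
  ones highs : List ℕ
  ones  = filter (_≤? 1) w
  highs = filter (∁? (_≤? 1)) w
  i : Interleaving ones highs w
  i = interleaving-filter (_≤? 1) w
  1≤ones,highs : All (1 ≤_) ones × All (1 ≤_) highs
  1≤ones,highs = All-interleaving⁻ 1≤w i
  ones≡ : ones ≡ replicate (length w ∸ length (lower w)) 1
  ones≡ = begin
    ones                                      ≡⟨ replicate-1 (all-filter (_≤? 1) w) (proj₁ 1≤ones,highs) ⟩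
    replicate (length ones) 1                 ≡⟨ cong (λ n → replicate n 1) (m+n∸n≡m (length ones) (length highs)) ⟨
    replicate (length ones + length highs ∸ length highs) 1
      ≡⟨ cong₂ (λ n m → replicate (n ∸ m) 1) (interleave-length i) (length-map pred highs) ⟨
    replicate (length w ∸ length (lower w)) 1 ∎
  highs≡ : highs ≡ map suc (lower w)
  highs≡ = sym (map-suc-pred (proj₂ 1≤ones,highs))

∈-withOnes⁻ : ∀ {s j d w} → All (InRange s) d → w ∈ withOnes j d →
              length w ≡ j + length d × All (InRange (suc s)) w × lower w ≡ d
∈-withOnes⁻ {s} {j} {d} {w} d∈[1,s] w∈ =
  trans (interleave-length i) (cong₂ _+_ (length-replicate j) (length-map suc d)) ,
  All-interleaving⁺ (ones∈[1,1+s] j) (suc∈[1,1+s] d∈[1,s]) i ,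
  interleaving⇒lower (All.map proj₁ d∈[1,s]) i
  where
  i : Interleaving (replicate j 1) (map suc d) w
  i = ∈-shuffles⁻ (replicate j 1) (map suc d) w∈
  ones∈[1,1+s] : ∀ j → All (InRange (suc s)) (replicate j 1)
  ones∈[1,1+s] zero    = []
  ones∈[1,1+s] (suc j) = (≤-refl , s≤s z≤n) ∷ ones∈[1,1+s] j
  suc∈[1,1+s] : ∀ {d} → All (InRange s) d → All (InRange (suc s)) (map suc d)
  suc∈[1,1+s] []                    = []
  suc∈[1,1+s] ((_ , x≤s) ∷ d∈[1,s]) = (s≤s z≤n , s≤s x≤s) ∷ suc∈[1,1+s] d∈[1,s]

parkingFunctions : ℕ → ℕ → List (List ℕ)
parkingFunctions r       (suc s) with r ≤? suc s
... | no  _ = []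
... | yes _ = concatMap (λ b → concatMap (withOnes (r ∸ b)) (parkingFunctions b s)) (upTo (suc r))
parkingFunctions zero    zero    = [] ∷ []
parkingFunctions (suc r) zero    = []

∈-parkingFunctions⁻ : ∀ r s {w} → w ∈ parkingFunctions r s → length w ≡ r × IsPFʳ s w
∈-parkingFunctions⁻ zero zero (here refl) = refl , refl
∈-parkingFunctions⁻ r (suc s) {w} w∈ with r ≤? suc s
∈-parkingFunctions⁻ r (suc s) () | no _
... | yes r≤1+s
  with b , b∈ , w∈′ ← find (∈-concatMap⁻ _ w∈)
  with d , d∈ , w∈″ ← find (∈-concatMap⁻ _ w∈′)
  with length-d , d-PF ← ∈-parkingFunctions⁻ b s d∈
  with length-w , w∈[1,1+s] , lower-w ← ∈-withOnes⁻ (IsPFʳ⇒InRange s d-PF) w∈″ =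
  length-w≡r , w∈[1,1+s] , subst (_≤ suc s) (sym length-w≡r) r≤1+s , subst (IsPFʳ s) (sym lower-w) d-PF
  where
  length-w≡r : length w ≡ r
  length-w≡r = trans length-w (trans (cong (r ∸ b +_) length-d) (m∸n+n≡m (≤-pred (∈-upTo⁻ b∈))))

∈-parkingFunctions⁺ : ∀ r s {w} → length w ≡ r → IsPFʳ s w → w ∈ parkingFunctions r s
∈-parkingFunctions⁺ r (suc s) {w} refl (w∈[1,1+s] , length≤ , lower-PF) with r ≤? suc s
... | no r≰1+s = ⊥-elim (r≰1+s length≤)
... | yes _ =
  ∈-concatMap⁺ _ (lose (∈-upTo⁺ (s≤s b≤r))
    (∈-concatMap⁺ _ (lose (∈-parkingFunctions⁺ b s refl lower-PF)
      (∈-shuffles⁺ (interleaving-lower (All.map proj₁ w∈[1,1+s]))))))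
  where
  b : ℕ
  b = length (lower w)
  b≤r : b ≤ length w
  b≤r = subst (_≤ length w) (sym (length-map pred (filter (∁? (_≤? 1)) w))) (length-filter (∁? (_≤? 1)) w)
∈-parkingFunctions⁺ zero    zero _  refl = here refl
∈-parkingFunctions⁺ (suc r) zero () refl

Unique-parkingFunctions : ∀ r s → Unique (parkingFunctions r s)
Unique-parkingFunctions r (suc s) with r ≤? suc s
... | no  _ = []
... | yes _ = Unique-concatMap⁺ layer (Uniqueₚ.upTo⁺ (suc r)) (λ _ → Unique-layer) layers-disjoint
  where
  layer : ℕ → List (List ℕ)
  layer b = concatMap (withOnes (r ∸ b)) (parkingFunctions b s)
  lower-of : ∀ {b d w} → d ∈ parkingFunctions b s → w ∈ withOnes (r ∸ b) d → lower w ≡ d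
  lower-of {b} d∈ w∈ =
    proj₂ (proj₂ (∈-withOnes⁻ {j = r ∸ b} (IsPFʳ⇒InRange s (proj₂ (∈-parkingFunctions⁻ b s d∈))) w∈))
  Unique-layer : ∀ {b} → Unique (layer b)
  Unique-layer {b} = Unique-concatMap⁺ (withOnes (r ∸ b)) (Unique-parkingFunctions b s)
    (λ d∈ → Unique-shuffles (Disjoint-All-∁ (All-≤1-replicate (r ∸ b))
              (All-≰1-map-suc (All.map proj₁ (IsPFʳ⇒InRange s (proj₂ (∈-parkingFunctions⁻ b s d∈)))))))
    (λ d∈ d′∈ w∈ w∈′ → trans (sym (lower-of d∈ w∈)) (lower-of d′∈ w∈′))
  length-lower : ∀ {b w} → w ∈ layer b → length (lower w) ≡ b
  length-lower {b} w∈ with d , d∈ , w∈′ ← find (∈-concatMap⁻ (withOnes (r ∸ b)) w∈) =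
    trans (cong length (lower-of d∈ w∈′)) (proj₁ (∈-parkingFunctions⁻ b s d∈))
  layers-disjoint : ∀ {b b′ w} → b ∈ upTo (suc r) → b′ ∈ upTo (suc r) →
                    w ∈ layer b → w ∈ layer b′ → b ≡ b′
  layers-disjoint _ _ w∈ w∈′ = trans (sym (length-lower w∈)) (length-lower w∈′)
Unique-parkingFunctions zero    zero = [] ∷ []
Unique-parkingFunctions (suc r) zero = []

length-withOnes : ∀ j d → length (withOnes j d) ≡ (j + length d) C length d
length-withOnes j d = trans (length-shuffles (replicate j 1) (map suc d))
  (cong₂ (λ a b → (a + b) C b) (length-replicate j) (length-map suc d))

length-parkingFunctions : ∀ r s → r ≤ suc s → length (parkingFunctions r s) ≡ pfCount r s
length-parkingFunctions r (suc s) r≤2+s with r ≤? suc s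
... | no r≰1+s with refl ← ≤-antisym r≤2+s (≰⇒> r≰1+s) = sym (cong (_* suc (suc s) ^ suc s) (n∸n≡0 s))
... | yes r≤1+s = begin
  length (concatMap (λ b → concatMap (withOnes (r ∸ b)) (parkingFunctions b s)) (upTo (suc r)))
    ≡⟨ length-concatMap-applyUpTo (λ b → concatMap (withOnes (r ∸ b)) (parkingFunctions b s)) r (λ b → b) ⟩
  ∑≤ r (λ b → length (concatMap (withOnes (r ∸ b)) (parkingFunctions b s)))
    ≡⟨ ∑≤-cong r (λ {b} b≤r → trans (length-concatMap-const (withOnes (r ∸ b)) (length-layer b≤r))
                                     (*-comm (length (parkingFunctions b s)) _)) ⟩
  ∑≤ r (λ b → (r C b) * length (parkingFunctions b s))
    ≡⟨ ∑≤-cong r (λ {b} b≤r → cong ((r C b) *_) (length-parkingFunctions b s (≤-trans b≤r r≤1+s))) ⟩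
  ∑≤ r (λ b → (r C b) * pfCount b s)
    ≡⟨ ∑≤-pfCount r s r≤1+s ⟩
  pfCount r (suc s) ∎
  where
  length-layer : ∀ {b d} → b ≤ r → d ∈ parkingFunctions b s → length (withOnes (r ∸ b) d) ≡ r C b
  length-layer {b} {d} b≤r d∈ = trans (length-withOnes (r ∸ b) d)
    (subst (λ n → (r ∸ b + n) C n ≡ r C b) (sym (proj₁ (∈-parkingFunctions⁻ b s d∈)))
           (cong (_C b) (m∸n+n≡m b≤r)))
length-parkingFunctions zero          zero _ = refl
length-parkingFunctions (suc zero)    zero _ = refl
length-parkingFunctions (suc (suc r)) zero (s≤s ())

-- Sorted parking functions

IsPFʳ-resp-↭ : ∀ s {c c′} → c ↭ c′ → IsPFʳ s c → IsPFʳ s c′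
IsPFʳ-resp-↭ zero    c↭c′ refl = ↭-empty-inv (↭-sym c↭c′)
IsPFʳ-resp-↭ (suc s) c↭c′ (c∈[1,1+s] , length≤ , lower-PF) =
  All-resp-↭ c↭c′ c∈[1,1+s] ,
  subst (_≤ suc s) (↭-length c↭c′) length≤ ,
  IsPFʳ-resp-↭ s (↭.map⁺ pred (filter-↭ (∁? (_≤? 1)) c↭c′)) lower-PF

-- Bounded t n c says that the i-th entry of c (counting from 1) is at most t - n + i; the
-- parking condition c′ᵢ ≤ s - r + i on the sorted sequence is Bounded s r c′.
Bounded : ℕ → ℕ → List ℕ → Set
Bounded t n []      = ⊤
Bounded t n (x ∷ c) = x + n ≤ suc t × Bounded (suc t) n c

lookup⇔Bounded : ∀ t n c → (∀ (i : Fin (length c)) → lookup c i + n ≤ t + suc (toℕ i)) ⇔ Bounded t n c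
lookup⇔Bounded t n []      = mk⇔ (λ _ → tt) (λ _ ())
lookup⇔Bounded t n (x ∷ c) = mk⇔
  (λ bound → subst (x + n ≤_) (+-comm t 1) (bound zero) ,
             to (lookup⇔Bounded (suc t) n c) (λ i → subst (lookup c i + n ≤_) (+-suc t (suc (toℕ i))) (bound (suc i))))
  λ { (x-bound , c-bound) → λ
        { zero    → subst (x + n ≤_) (+-comm 1 t) x-bound
        ; (suc i) → subst (lookup c i + n ≤_) (sym (+-suc t (suc (toℕ i))))
                          (from (lookup⇔Bounded (suc t) n c) c-bound i) } }

Bounded-suc : ∀ t n c → Bounded (suc t) (suc n) c ⇔ Bounded t n c
Bounded-suc t n []      = mk⇔ id id
Bounded-suc t n (x ∷ c) = mk⇔
  (λ (x-bound , c-bound) → ≤-pred (subst (_≤ suc (suc t)) (+-suc x n) x-bound) , to (Bounded-suc (suc t) n c) c-bound)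
  (λ (x-bound , c-bound) → subst (_≤ suc (suc t)) (sym (+-suc x n)) (s≤s x-bound) , from (Bounded-suc (suc t) n c) c-bound)

Bounded-pred : ∀ t n {c} → All (1 ≤_) c → Bounded (suc t) n c ⇔ Bounded t n (map pred c)
Bounded-pred t n []                    = mk⇔ id id
Bounded-pred t n {suc x ∷ c} (_ ∷ 1≤c) = mk⇔
  (λ (x-bound , c-bound) → ≤-pred x-bound , to (Bounded-pred (suc t) n 1≤c) c-bound)
  (λ (x-bound , c-bound) → s≤s x-bound , from (Bounded-pred (suc t) n 1≤c) c-bound)

IsPFʳ-[] : ∀ s → IsPFʳ s []
IsPFʳ-[] zero    = refl
IsPFʳ-[] (suc s) = [] , z≤n , IsPFʳ-[] s

Bounded⇔IsPFʳ-1∷ : ∀ s c → All (InRange (suc s)) c → Bounded (suc s) (length c) c ⇔ IsPFʳ (suc s) c →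
                   Bounded (suc s) (suc (length c)) (1 ∷ c) ⇔ IsPFʳ (suc s) (1 ∷ c)
Bounded⇔IsPFʳ-1∷ s c c∈[1,1+s] ih = mk⇔
  (λ (1-bound , c-bound) →
     (≤-refl , s≤s z≤n) ∷ c∈[1,1+s] , ≤-pred 1-bound ,
     proj₂ (proj₂ (to ih (to (Bounded-suc (suc s) (length c) c) c-bound))))
  (λ (_ , length≤ , lower-PF) →
     s≤s length≤ ,
     from (Bounded-suc (suc s) (length c) c) (from ih (c∈[1,1+s] , m≤n⇒m≤1+n (≤-pred length≤) , lower-PF)))

Bounded⇔IsPFʳ-≥2 : ∀ s c → All (2 ≤_) c → All (InRange (suc s)) c →
                   Bounded s (length (map pred c)) (map pred c) ⇔ IsPFʳ s (map pred c) →
                   Bounded (suc s) (length c) c ⇔ IsPFʳ (suc s) c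
Bounded⇔IsPFʳ-≥2 s c 2≤c c∈[1,1+s] ih = mk⇔
  (λ c-bound → let lowered-PF = to ih (Bounded-lowered c-bound) in
     c∈[1,1+s] , length≤ lowered-PF , subst (IsPFʳ s) (sym lower-c) lowered-PF)
  (λ (_ , _ , lower-PF) →
     from (Bounded-pred s n 1≤c) (subst (λ m → Bounded s m (map pred c)) (length-map pred c)
       (from ih (subst (IsPFʳ s) lower-c lower-PF))))
  where
  n : ℕ
  n = length c
  1≤c : All (1 ≤_) c
  1≤c = All.map (≤-trans (n≤1+n 1)) 2≤c
  lower-c : lower c ≡ map pred c
  lower-c = cong (map pred) (filter-all (∁? (_≤? 1)) (All.map <⇒≱ 2≤c))
  Bounded-lowered : Bounded (suc s) n c → Bounded s (length (map pred c)) (map pred c)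
  Bounded-lowered c-bound =
    subst (λ m → Bounded s m (map pred c)) (sym (length-map pred c)) (to (Bounded-pred s n 1≤c) c-bound)
  length≤ : IsPFʳ s (map pred c) → length c ≤ suc s
  length≤ lowered-PF = m≤n⇒m≤1+n (subst (_≤ s) (length-map pred c) (IsPFʳ⇒length≤ s lowered-PF))

pred-InRange : ∀ s {c} → All (2 ≤_) c → All (InRange (suc s)) c → All (InRange s) (map pred c)
pred-InRange s []                 []                        = []
pred-InRange s {suc x ∷ _} (s≤s 1≤x ∷ 2≤c) ((_ , s≤s x≤s) ∷ c∈) = (1≤x , x≤s) ∷ pred-InRange s 2≤c c∈

-- On sorted sequences the recursion of IsPFʳ either strips a leading 1 (when there is one)
-- or, when every entry is at least 2, lowers all entries at once.
sorted⇒Bounded⇔IsPFʳ : ∀ s c → Linked _≤_ c → All (InRange s) c → Bounded s (length c) c ⇔ IsPFʳ s c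
sorted⇒Bounded⇔IsPFʳ zero    []      _ _                  = mk⇔ (λ _ → refl) (λ _ → tt)
sorted⇒Bounded⇔IsPFʳ zero    (x ∷ c) _ ((1≤x , x≤0) ∷ _) = ⊥-elim (<⇒≱ 1≤x x≤0)
sorted⇒Bounded⇔IsPFʳ (suc s) []      _ _                  = mk⇔ (λ _ → IsPFʳ-[] (suc s)) (λ _ → tt)
sorted⇒Bounded⇔IsPFʳ (suc s) (1 ∷ c) sorted (_ ∷ c∈[1,1+s]) =
  Bounded⇔IsPFʳ-1∷ s c c∈[1,1+s] (sorted⇒Bounded⇔IsPFʳ (suc s) c (Linked.tail sorted) c∈[1,1+s])
sorted⇒Bounded⇔IsPFʳ (suc s) (suc (suc x) ∷ c) sorted c∈[1,1+s] =
  Bounded⇔IsPFʳ-≥2 s (suc (suc x) ∷ c) 2≤c c∈[1,1+s]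
    (sorted⇒Bounded⇔IsPFʳ s (map pred (suc (suc x) ∷ c)) (Linkedₚ.map⁺ (Linked.map pred-mono-≤ sorted))
                                                        (pred-InRange s 2≤c c∈[1,1+s]))
  where
  2≤c : All (2 ≤_) (suc (suc x) ∷ c)
  2≤c = Linked⇒All ≤-trans (s≤s (s≤s z≤n)) sorted

IsPF⇔IsPFʳ : ∀ s c → IsPF s c ⇔ IsPFʳ s c
IsPF⇔IsPFʳ s c = mk⇔
  (λ (c∈[1,s] , c′ , c′↭c , sorted , bound) →
     IsPFʳ-resp-↭ s c′↭c
       (to (sorted⇒Bounded⇔IsPFʳ s c′ sorted (All-resp-↭ (↭-sym c′↭c) c∈[1,s]))
           (to (lookup⇔Bounded s (length c′) c′)
               (λ i → subst (λ n → lookup c′ i + n ≤ s + suc (toℕ i)) (sym (↭-length c′↭c)) (bound i)))))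
  (λ c-PF →
     let sorted-PF = IsPFʳ-resp-↭ s (↭-sym (sort-↭ c)) c-PF in
     IsPFʳ⇒InRange s c-PF , sort c , sort-↭ c , sort-↗ c ,
     λ i → subst (λ n → lookup (sort c) i + n ≤ s + suc (toℕ i)) (↭-length (sort-↭ c))
             (from (lookup⇔Bounded s _ (sort c))
                   (from (sorted⇒Bounded⇔IsPFʳ s (sort c) (sort-↗ c) (IsPFʳ⇒InRange s sorted-PF)) sorted-PF) i))

∈parkingFunctions⇔IsPF : ∀ r s w → w ∈ parkingFunctions r s ⇔ (IsPF s w × length w ≡ r)
∈parkingFunctions⇔IsPF r s w = mk⇔
  (λ w∈ → let length-w , w-PF = ∈-parkingFunctions⁻ r s w∈ in from (IsPF⇔IsPFʳ s w) w-PF , length-w)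
  (λ (w-PF , length-w) → ∈-parkingFunctions⁺ r s length-w (to (IsPF⇔IsPFʳ s w) w-PF))

-- Counting Sh_m(k-1, n-k)

HasSize-⇔ : ∀ {P Q : List ℕ → Set} {N} → (∀ w → P w ⇔ Q w) → HasSize P N → HasSize Q N
HasSize-⇔ P⇔Q (xs , unique , ∈xs⇔P , length-xs) =
  xs , unique , (λ w → to (P⇔Q w) ∘ proj₁ (∈xs⇔P w) , proj₂ (∈xs⇔P w) ∘ from (P⇔Q w)) , length-xs

HasSize-empty : ∀ {P : List ℕ → Set} → (∀ w → ¬ P w) → HasSize P 0
HasSize-empty ¬P = [] , [] , (λ w → (λ ()) , ⊥-elim ∘ ¬P w) , refl

All-≰-map-+ : ∀ s b → All (∁ (_≤ s)) (map (_+ suc s) b)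
All-≰-map-+ s []      = []
All-≰-map-+ s (x ∷ b) = <⇒≱ (m≤n+m (suc s) x) ∷ All-≰-map-+ s b

-- Sh_m(k-1, n-k) for k = s + 1, n - k = t and m = r + t + 1.
ShufflePF : ℕ → ℕ → ℕ → List ℕ → Set
ShufflePF r s t w = Σ (List ℕ) λ γ → Σ (List ℕ) λ b →
  IsPF s γ × length γ ≡ r × IsPF t b × length b ≡ t × Interleaving γ (map (_+ suc s) b) w

module _ (r s t : ℕ) where

  lowPFs raisedPFs : List (List ℕ)
  lowPFs    = parkingFunctions r s
  raisedPFs = map (map (_+ suc s)) (parkingFunctions t t)

  withRaised : List ℕ → List (List ℕ)
  withRaised γ = concatMap (shuffles γ) raisedPFs

  shufflesPF : List (List ℕ)
  shufflesPF = concatMap withRaised lowPFs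

  lowPF≤s : ∀ {γ} → γ ∈ lowPFs → All (_≤ s) γ
  lowPF≤s γ∈ = All.map proj₂ (IsPFʳ⇒InRange s (proj₂ (∈-parkingFunctions⁻ r s γ∈)))

  raisedPF≰s : ∀ {b′} → b′ ∈ raisedPFs → All (∁ (_≤ s)) b′
  raisedPF≰s b′∈ with b , _ , refl ← ∈-map⁻ (map (_+ suc s)) b′∈ = All-≰-map-+ s b

  shuffle-split : ∀ {γ b′ w} → γ ∈ lowPFs → b′ ∈ raisedPFs → w ∈ shuffles γ b′ →
                  filter (_≤? s) w ≡ γ × filter (∁? (_≤? s)) w ≡ b′
  shuffle-split γ∈ b′∈ w∈ =
    interleaving⇒filter (_≤? s) (lowPF≤s γ∈) (raisedPF≰s b′∈) (∈-shuffles⁻ _ _ w∈)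

  Unique-withRaised : ∀ {γ} → γ ∈ lowPFs → Unique (withRaised γ)
  Unique-withRaised {γ} γ∈ =
    Unique-concatMap⁺ (shuffles γ) (Uniqueₚ.map⁺ (map-injective (+-cancelʳ-≡ _ _ _)) (Unique-parkingFunctions t t))
      (λ b′∈ → Unique-shuffles (Disjoint-All-∁ (lowPF≤s γ∈) (raisedPF≰s b′∈)))
      (λ b₁∈ b₂∈ w∈₁ w∈₂ →
         trans (sym (proj₂ (shuffle-split γ∈ b₁∈ w∈₁))) (proj₂ (shuffle-split γ∈ b₂∈ w∈₂)))

  filter-withRaised : ∀ {γ w} → γ ∈ lowPFs → w ∈ withRaised γ → filter (_≤? s) w ≡ γ
  filter-withRaised {γ} γ∈ w∈ with _ , b′∈ , w∈′ ← find (∈-concatMap⁻ (shuffles γ) w∈) =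
    proj₁ (shuffle-split γ∈ b′∈ w∈′)

  Unique-shufflesPF : Unique shufflesPF
  Unique-shufflesPF = Unique-concatMap⁺ withRaised (Unique-parkingFunctions r s) Unique-withRaised
    λ γ₁∈ γ₂∈ w∈₁ w∈₂ → trans (sym (filter-withRaised γ₁∈ w∈₁)) (filter-withRaised γ₂∈ w∈₂)

  ∈-shufflesPF⁻ : ∀ {w} → w ∈ shufflesPF → ShufflePF r s t w
  ∈-shufflesPF⁻ w∈ with γ , γ∈ , w∈′ ← find (∈-concatMap⁻ withRaised w∈)
                   with b′ , b′∈ , w∈″ ← find (∈-concatMap⁻ (shuffles γ) w∈′)
                   with b , b∈ , refl ← ∈-map⁻ (map (_+ suc s)) b′∈ =
    let γ-PF , length-γ = to (∈parkingFunctions⇔IsPF r s γ) γ∈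
        b-PF , length-b = to (∈parkingFunctions⇔IsPF t t b) b∈
    in γ , b , γ-PF , length-γ , b-PF , length-b , ∈-shuffles⁻ γ _ w∈″

  ∈-shufflesPF⁺ : ∀ {w} → ShufflePF r s t w → w ∈ shufflesPF
  ∈-shufflesPF⁺ (γ , b , γ-PF , length-γ , b-PF , length-b , i) =
    ∈-concatMap⁺ withRaised (lose (from (∈parkingFunctions⇔IsPF r s γ) (γ-PF , length-γ))
      (∈-concatMap⁺ (shuffles γ)
        (lose (∈-map⁺ (map (_+ suc s)) (from (∈parkingFunctions⇔IsPF t t b) (b-PF , length-b)))
              (∈-shuffles⁺ i))))

  length-withRaised : ∀ {γ} → γ ∈ lowPFs → length (withRaised γ) ≡ pfCount t t * ((r + t) C t)
  length-withRaised {γ} γ∈ = begin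
    length (withRaised γ)
      ≡⟨ length-concatMap-const (shuffles γ) length-shuffle ⟩
    length raisedPFs * ((r + t) C t)
      ≡⟨ cong (_* ((r + t) C t)) (length-map (map (_+ suc s)) (parkingFunctions t t)) ⟩
    length (parkingFunctions t t) * ((r + t) C t)
      ≡⟨ cong (_* ((r + t) C t)) (length-parkingFunctions t t (n≤1+n t)) ⟩
    pfCount t t * ((r + t) C t) ∎
    where
    length-shuffle : ∀ {b′} → b′ ∈ raisedPFs → length (shuffles γ b′) ≡ (r + t) C t
    length-shuffle b′∈ with b , b∈ , refl ← ∈-map⁻ (map (_+ suc s)) b′∈ =
      trans (length-shuffles γ (map (_+ suc s) b))
            (cong₂ (λ p q → (p + q) C q) (proj₁ (∈-parkingFunctions⁻ r s γ∈))
                   (trans (length-map (_+ suc s) b) (proj₁ (∈-parkingFunctions⁻ t t b∈))))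

  length-shufflesPF : r ≤ suc s → length shufflesPF ≡ pfCount r s * (pfCount t t * ((r + t) C t))
  length-shufflesPF r≤1+s = begin
    length shufflesPF
      ≡⟨ length-concatMap-const withRaised length-withRaised ⟩
    length lowPFs * (pfCount t t * ((r + t) C t))
      ≡⟨ cong (_* (pfCount t t * ((r + t) C t))) (length-parkingFunctions r s r≤1+s) ⟩
    pfCount r s * (pfCount t t * ((r + t) C t)) ∎

HasSize-ShufflePF : ∀ r s t → r ≤ suc s →
  HasSize (ShufflePF r s t) (pfCount r s * (pfCount t t * ((r + t) C t)))
HasSize-ShufflePF r s t r≤1+s =
  shufflesPF r s t , Unique-shufflesPF r s t , (λ w → ∈-shufflesPF⁻ r s t , ∈-shufflesPF⁺ r s t) ,
  length-shufflesPF r s t r≤1+s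

ShufflePF⇔IsSh : ∀ r s t w → ShufflePF r s t w ⇔ IsSh (r + t + 1) (suc s + t) (suc s) w
ShufflePF⇔IsSh r s t w rewrite m+n∸m≡n (suc s) t = mk⇔
  (λ (γ , b , γ-PF , length-γ , rest) → γ , b , γ-PF , cong (λ g → g + t + 1) length-γ , rest)
  (λ (γ , b , γ-PF , length-γ , rest) → γ , b , γ-PF , +-cancelʳ-≡ t _ _ (+-cancelʳ-≡ 1 _ _ length-γ) , rest)

m+a∸m+1≡1+a : ∀ m a → m + a ∸ m + 1 ≡ suc a
m+a∸m+1≡1+a m a = trans (cong (_+ 1) (m+n∸m≡n m a)) (+-comm a 1)

shCount-≡ : ∀ m n k {r t c e} → m ∸ 1 ≡ r + t → n ∸ k ≡ t → n ∸ m + 1 ≡ c → m + k ∸ (n + 2) ≡ e →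
            shCount m n k ≡ ((r + t) C t) * c * k ^ e * pfCount t t
shCount-≡ m n k {r} {t} {c} {e} m∸1≡ n∸k≡ n∸m+1≡ m+k∸[n+2]≡
  rewrite m∸1≡ | n∸k≡ | n∸m+1≡ | m+k∸[n+2]≡ =
  cong (((r + t) C t) * c * k ^ e *_) (sym (pfCount-diagonal t))

above-shape : ∀ {m n k} → m ≤ n → k ≤ n → n ∸ m + 1 < k →
  ∃ λ a → ∃ λ r′ → ∃ λ t → m ≡ suc r′ + t + 1 × n ≡ suc (suc (a + r′)) + t × k ≡ suc (suc (a + r′))
above-shape {m} {k = k} m≤n k≤n n∸m+1<k
  with a , refl ← m≤n⇒∃[o]m+o≡n m≤n
  with r′ , refl ← m≤n⇒∃[o]m+o≡n (subst (λ x → suc x ≤ k) (m+a∸m+1≡1+a m a) n∸m+1<k)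
  with t , k+t≡n ← m≤n⇒∃[o]m+o≡n k≤n =
  a , r′ , t , +-cancelʳ-≡ a m (suc r′ + t + 1) (trans (sym k+t≡n) (reorder a r′ t)) , sym k+t≡n , refl
  where
  reorder : ∀ a r′ t → suc (suc (a + r′)) + t ≡ suc r′ + t + 1 + a
  reorder = solve-∀

boundary-shape : ∀ {m n k} → m ≤ n → k ≤ n → k ≡ n ∸ m + 1 →
  ∃ λ s → ∃ λ t → m ≡ 0 + t + 1 × n ≡ suc s + t × k ≡ suc s
boundary-shape {m} m≤n k≤n k≡n∸m+1
  with a , refl ← m≤n⇒∃[o]m+o≡n m≤n
  with refl ← trans k≡n∸m+1 (m+a∸m+1≡1+a m a)
  with t , k+t≡n ← m≤n⇒∃[o]m+o≡n k≤n =
  a , t , +-cancelʳ-≡ a m (t + 1) (trans (sym k+t≡n) (reorder a t)) , sym k+t≡n , refl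
  where
  reorder : ∀ a t → suc a + t ≡ t + 1 + a
  reorder = solve-∀

¬IsSh-below : ∀ {m n k} → m ≤ n → k < n ∸ m + 1 → ∀ w → ¬ IsSh m n k w
¬IsSh-below {m} {n} {k} m≤n k<n∸m+1 w (γ , _ , _ , length-γ , _) = <⇒≱ n∸k<m m≤n∸k
  where
  m≤n∸k : m ≤ n ∸ k
  m≤n∸k = subst (_≤ n ∸ k) (m∸[m∸n]≡n m≤n)
                (∸-monoʳ-≤ n (≤-pred (subst (k <_) (+-comm (n ∸ m) 1) k<n∸m+1)))
  n∸k<m : n ∸ k < m
  n∸k<m = subst (n ∸ k <_) (trans (+-comm 1 _) length-γ) (s≤s (m≤n+m (n ∸ k) (length γ)))

HasSize-IsSh-above : ∀ {m n k} → m ≤ n → k ≤ n → n ∸ m + 1 < k → HasSize (IsSh m n k) (shCount m n k)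
HasSize-IsSh-above m≤n k≤n n∸m+1<k with a , r′ , t , refl , refl , refl ← above-shape m≤n k≤n n∸m+1<k =
  subst (HasSize _) (sym count≡) (HasSize-⇔ (ShufflePF⇔IsSh r s t) (HasSize-ShufflePF r s t r≤1+s))
  where
  r s : ℕ
  r = suc r′
  s = suc (a + r′)
  r≤1+s : r ≤ suc s
  r≤1+s = s≤s (m≤n⇒m≤1+n (m≤n+m r′ a))
  count≡ : shCount (r + t + 1) (suc s + t) (suc s) ≡ pfCount r s * (pfCount t t * ((r + t) C t))
  count≡ = begin
    shCount (r + t + 1) (suc s + t) (suc s)
      ≡⟨ shCount-≡ (r + t + 1) (suc s + t) (suc s)
                   (+-comm (r′ + t) 1) (m+n∸m≡n (suc s) t) n∸m+1≡1+a m+k∸[n+2]≡r′ ⟩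
    ((r + t) C t) * suc a * suc s ^ r′ * pfCount t t
      ≡⟨ rearrange ((r + t) C t) (suc a) (suc s ^ r′) (pfCount t t) ⟩
    (suc a * suc s ^ r′) * (pfCount t t * ((r + t) C t))
      ≡⟨ cong (λ c → c * suc s ^ r′ * (pfCount t t * ((r + t) C t))) (m+n∸n≡m (suc a) r′) ⟨
    pfCount r s * (pfCount t t * ((r + t) C t)) ∎
    where
    n≡m+a : ∀ a r′ t → suc (suc (a + r′)) + t ≡ suc r′ + t + 1 + a
    n≡m+a = solve-∀
    m+k≡r′+[n+2] : ∀ a r′ t → suc r′ + t + 1 + suc (suc (a + r′)) ≡ r′ + (suc (suc (a + r′)) + t + 2)
    m+k≡r′+[n+2] = solve-∀
    rearrange : ∀ x c p q → x * c * p * q ≡ c * p * (q * x)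
    rearrange = solve-∀
    n∸m+1≡1+a : suc s + t ∸ (r + t + 1) + 1 ≡ suc a
    n∸m+1≡1+a = trans (cong (λ n → n ∸ (r + t + 1) + 1) (n≡m+a a r′ t)) (m+a∸m+1≡1+a (r + t + 1) a)
    m+k∸[n+2]≡r′ : r + t + 1 + suc s ∸ (suc s + t + 2) ≡ r′
    m+k∸[n+2]≡r′ = trans (cong (_∸ (suc s + t + 2)) (m+k≡r′+[n+2] a r′ t)) (m+n∸n≡m r′ (suc s + t + 2))

HasSize-IsSh-boundary : ∀ {m n k} → m ≤ n → k ≤ n → k ≡ n ∸ m + 1 → HasSize (IsSh m n k) (m ^ (m ∸ 2))
HasSize-IsSh-boundary m≤n k≤n k≡n∸m+1 with s , t , refl , refl , refl ← boundary-shape m≤n k≤n k≡n∸m+1 =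
  subst (HasSize _) count≡ (HasSize-⇔ (ShufflePF⇔IsSh 0 s t) (HasSize-ShufflePF 0 s t z≤n))
  where
  count≡ : pfCount 0 s * (pfCount t t * ((0 + t) C t)) ≡ (t + 1) ^ (t + 1 ∸ 2)
  count≡ = begin
    1 * (pfCount t t * (t C t)) ≡⟨ cong (λ c → 1 * (pfCount t t * c)) (nCn≡1 t) ⟩
    1 * (pfCount t t * 1)       ≡⟨ trans (*-identityˡ _) (*-identityʳ _) ⟩
    pfCount t t                 ≡⟨ pfCount-diagonal t ⟩
    (t + 1) ^ (t ∸ 1)           ≡⟨ cong (λ e → (t + 1) ^ (e ∸ 2)) (+-comm 1 t) ⟩
    (t + 1) ^ (t + 1 ∸ 2)       ∎

lemma4p7 : (m n k : ℕ) → 1 ≤ m → m ≤ n → 1 ≤ k → k ≤ n →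
    (n ∸ m + 1 < k → HasSize (IsSh m n k) (shCount m n k)) ×
    (k ≡ n ∸ m + 1 → HasSize (IsSh m n k) (m ^ (m ∸ 2))) ×
    (k < n ∸ m + 1 → HasSize (IsSh m n k) 0)
lemma4p7 m n k _ m≤n _ k≤n =
  HasSize-IsSh-above m≤n k≤n ,
  HasSize-IsSh-boundary m≤n k≤n ,
  λ k<n∸m+1 → HasSize-empty (¬IsSh-below m≤n k<n∸m+1)
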